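{- Let $N$ be a matroid. There is a sentence $\mathbf{S}_N$ in $M$-logic such that a structure $(E,r)$ is a matroid having a minor isomorphic to $N$ if and only if $(E,r)$ satisfies $\{\mathbf{R1},\mathbf{R2},\mathbf{R3},\mathbf{S}_N\}$.
   Context: A structure is a pair $(E,r)$ where $E$ is a finite set and $r\colon\mathcal{P}(E)\to\mathbb{Z}_{\ge0}$. A matroid is a structure whose $r$ is a matroid rank function. Monadic second-order logic for matroids (MSOL): element variables $x_1,x_2,\dots$ and set variables $X_1,X_2,\dots$. Set terms are built from $E$, $\emptyset$, set variables, singletons $\{x_i\}$, and closed under complement, $\cup$, $\cap$. Integer terms are built from constants $0,1,2,\dots$, $|X|$ and $r(X)$ for set terms $X$, closed under $+$. Atomic formulas: $x=y$, $X=Y$, $X\subseteq Y$, $p=q$, $p\le q$, $x\in X$. Formulas are built using $\neg,\lor,\land$ and $\exists,\forall$ over element and set variables; sentences have no free variables. In a structure $(E,r)$, element variables range over $E$, set variables over subsets of $E$, $|X|$ is cardinality and $r(X)$ is the given function, all other symbols having their usual meaning. $M$-logic is the set of MSOL formulas equivalent to one of the form $Q_{1}X_{i_1}\cdots Q_{m}X_{i_m}\,Q'_{1}x_{j_1}\cdots Q'_{n}x_{j_n}\,P$ with $P$ quantifier-free, $X_{i_k}$ set variables, $x_{j_k}$ element variables, where all $Q_k$ are the same quantifier and all $Q'_k$ are the same quantifier. $\mathbf{R1}$: $\forall X_1\ r(X_1)\le|X_1|$; $\mathbf{R2}$: $\forall X_1\forall X_2\ X_1\subseteq X_2\to r(X_1)\le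 r(X_2)$; $\mathbf{R3}$: $\forall X_1\forall X_2\ r(X_1\cup X_2)+r(X_1\cap X_2)\le r(X_1)+r(X_2)$. -}

module Defs where

open import Data.Nat using (ℕ; zero; suc; _+_; _∸_; _≤_)
open import Data.Fin using (Fin)
open import Data.Fin.Properties using (any?) renaming (_≟_ to _≟ᶠ_)
open import Data.Fin.Subset using (Subset; ⁅_⁆; ∁; _∩_; _∪_; ∣_∣; _∈_; _∉_; _⊆_)
  renaming (⊥ to ∅ˢ; ⊤ to Eˢ)
open import Data.Fin.Subset.Properties using (_∈?_)
open import Data.Vec using (tabulate)
open import Data.Empty using (⊥)
open import Data.Product using (Σ; ∃; _×_; _,_)
open import Data.Sum using (_⊎_)
open import Relation.Nullary using (¬_; does)
open import Relation.Nullary.Decidable using (_×-dec_)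
open import Relation.Binary.PropositionalEquality using (_≡_)
open import Function.Bundles using (_⇔_)
open import Function.Definitions using (Injective)

record IsMatroid (n : ℕ) (r : Subset n → ℕ) : Set where
  field
    R1 : ∀ X → r X ≤ ∣ X ∣
    R2 : ∀ X Y → X ⊆ Y → r X ≤ r Y
    R3 : ∀ X Y → r (X ∪ Y) + r (X ∩ Y) ≤ r X + r Y

img : ∀ {m n} → (Fin m → Fin n) → Subset m → Subset n
img φ X = tabulate λ e → does (any? λ i → (i ∈? X) ×-dec (φ i ≟ᶠ e))

-- (E , r) has a minor M / C \ D (C, D disjoint) isomorphic to the matroid
-- (Fin m , rN).
record MinorIso (n : ℕ) (r : Subset n → ℕ) (m : ℕ) (rN : Subset m → ℕ) : Set where
  field
    C D      : Subset n
    disjoint : C ∩ D ≡ ∅ˢ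
    φ        : Fin m → Fin n
    φ-inj    : Injective _≡_ _≡_ φ
    φ-onto   : ∀ e → (e ∉ C × e ∉ D) ⇔ (∃ λ i → φ i ≡ e)
    φ-rank   : ∀ X → rN X ≡ r (img φ X ∪ C) ∸ r C

HasMinorIsoTo : (n : ℕ) (r : Subset n → ℕ) (m : ℕ) (rN : Subset m → ℕ) → Set
HasMinorIsoTo n r m rN = MinorIso n r m rN

-- Monadic second-order logic for matroids (well-scoped de Bruijn syntax):
-- k = number of element variables in scope, s = number of set variables.

data SetTerm (k s : ℕ) : Set where
  E    : SetTerm k s
  ∅    : SetTerm k s
  var  : Fin s → SetTerm k s
  sing : Fin k → SetTerm k s
  compl : SetTerm k s → SetTerm k s
  _∪ₜ_ : SetTerm k s → SetTerm k s → SetTerm k s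
  _∩ₜ_ : SetTerm k s → SetTerm k s → SetTerm k s

data IntTerm (k s : ℕ) : Set where
  const : ℕ → IntTerm k s
  card  : SetTerm k s → IntTerm k s
  rk    : SetTerm k s → IntTerm k s
  _+ₜ_  : IntTerm k s → IntTerm k s → IntTerm k s

data Quant : Set where
  ∃q ∀q : Quant

data Formula (k s : ℕ) : Set where
  eqE  : Fin k → Fin k → Formula k s
  eqS  : SetTerm k s → SetTerm k s → Formula k s
  subS : SetTerm k s → SetTerm k s → Formula k s
  eqI  : IntTerm k s → IntTerm k s → Formula k s
  leI  : IntTerm k s → IntTerm k s → Formula k s
  mem  : Fin k → SetTerm k s → Formula k s
  neg  : Formula k s → Formula k s
  or   : Formula k s → Formula k s → Formula k s
  and  : Formula k s → Formula k s → Formula k s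
  qe   : Quant → Formula (suc k) s → Formula k s
  qs   : Quant → Formula k (suc s) → Formula k s

Sentence : Set
Sentence = Formula 0 0

module _ {n : ℕ} (r : Subset n → ℕ) where

  ⟦_⟧ˢ : ∀ {k s} → SetTerm k s → (Fin k → Fin n) → (Fin s → Subset n) → Subset n
  ⟦ E ⟧ˢ ρ σ = Eˢ
  ⟦ ∅ ⟧ˢ ρ σ = ∅ˢ
  ⟦ var j ⟧ˢ ρ σ = σ j
  ⟦ sing i ⟧ˢ ρ σ = ⁅ ρ i ⁆
  ⟦ compl t ⟧ˢ ρ σ = ∁ (⟦ t ⟧ˢ ρ σ)
  ⟦ t ∪ₜ u ⟧ˢ ρ σ = ⟦ t ⟧ˢ ρ σ ∪ ⟦ u ⟧ˢ ρ σ
  ⟦ t ∩ₜ u ⟧ˢ ρ σ = ⟦ t ⟧ˢ ρ σ ∩ ⟦ u ⟧ˢ ρ σ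

  ⟦_⟧ⁱ : ∀ {k s} → IntTerm k s → (Fin k → Fin n) → (Fin s → Subset n) → ℕ
  ⟦ const c ⟧ⁱ ρ σ = c
  ⟦ card t ⟧ⁱ ρ σ = ∣ ⟦ t ⟧ˢ ρ σ ∣
  ⟦ rk t ⟧ⁱ ρ σ = r (⟦ t ⟧ˢ ρ σ)
  ⟦ p +ₜ q ⟧ⁱ ρ σ = ⟦ p ⟧ⁱ ρ σ + ⟦ q ⟧ⁱ ρ σ

  extE : ∀ {k} → Fin n → (Fin k → Fin n) → Fin (suc k) → Fin n
  extE a ρ Fin.zero = a
  extE a ρ (Fin.suc i) = ρ i

  extS : ∀ {s} → Subset n → (Fin s → Subset n) → Fin (suc s) → Subset n
  extS A σ Fin.zero = A
  extS A σ (Fin.suc j) = σ j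

  Sat : ∀ {k s} → Formula k s → (Fin k → Fin n) → (Fin s → Subset n) → Set
  Sat (eqE i j) ρ σ = ρ i ≡ ρ j
  Sat (eqS t u) ρ σ = ⟦ t ⟧ˢ ρ σ ≡ ⟦ u ⟧ˢ ρ σ
  Sat (subS t u) ρ σ = ⟦ t ⟧ˢ ρ σ ⊆ ⟦ u ⟧ˢ ρ σ
  Sat (eqI p q) ρ σ = ⟦ p ⟧ⁱ ρ σ ≡ ⟦ q ⟧ⁱ ρ σ
  Sat (leI p q) ρ σ = ⟦ p ⟧ⁱ ρ σ ≤ ⟦ q ⟧ⁱ ρ σ
  Sat (mem i t) ρ σ = ρ i ∈ ⟦ t ⟧ˢ ρ σ
  Sat (neg φ) ρ σ = ¬ Sat φ ρ σ
  Sat (or φ ψ) ρ σ = Sat φ ρ σ ⊎ Sat ψ ρ σ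
  Sat (and φ ψ) ρ σ = Sat φ ρ σ × Sat ψ ρ σ
  Sat (qe ∃q φ) ρ σ = Σ (Fin n) λ a → Sat φ (extE a ρ) σ
  Sat (qe ∀q φ) ρ σ = (a : Fin n) → Sat φ (extE a ρ) σ
  Sat (qs ∃q φ) ρ σ = Σ (Subset n) λ A → Sat φ ρ (extS A σ)
  Sat (qs ∀q φ) ρ σ = (A : Subset n) → Sat φ ρ (extS A σ)

  noVarE : Fin 0 → Fin n
  noVarE ()

  noVarS : Fin 0 → Subset n
  noVarS ()

  Satisfies : Sentence → Set
  Satisfies S = Sat S noVarE noVarS

X₁ X₂ : ∀ {k s} → SetTerm k (suc (suc s))
X₁ = var (Fin.suc Fin.zero)   -- outer quantified set variable
X₂ = var Fin.zero             -- inner quantified set variable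

𝐑1 : Sentence
𝐑1 = qs ∀q (leI (rk (var Fin.zero)) (card (var Fin.zero)))

𝐑2 : Sentence
𝐑2 = qs ∀q (qs ∀q (or (neg (subS X₁ X₂)) (leI (rk X₁) (rk X₂))))

𝐑3 : Sentence
𝐑3 = qs ∀q (qs ∀q (leI (rk (X₁ ∪ₜ X₂) +ₜ rk (X₁ ∩ₜ X₂)) (rk X₁ +ₜ rk X₂)))

data QF {k s : ℕ} : Formula k s → Set where
  qf-eqE  : ∀ {i j} → QF (eqE i j)
  qf-eqS  : ∀ {t u} → QF (eqS t u)
  qf-subS : ∀ {t u} → QF (subS t u)
  qf-eqI  : ∀ {p q} → QF (eqI p q)
  qf-leI  : ∀ {p q} → QF (leI p q)
  qf-mem  : ∀ {i t} → QF (mem i t)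
  qf-neg  : ∀ {φ} → QF φ → QF (neg φ)
  qf-or   : ∀ {φ ψ} → QF φ → QF ψ → QF (or φ ψ)
  qf-and  : ∀ {φ ψ} → QF φ → QF ψ → QF (and φ ψ)

data ElemBlock (Q' : Quant) : ∀ {k s} → Formula k s → Set where
  eb-base : ∀ {k s} {P : Formula k s} → QF P → ElemBlock Q' P
  eb-step : ∀ {k s} {φ : Formula (suc k) s} → ElemBlock Q' φ → ElemBlock Q' (qe Q' φ)

data SetBlock (Q Q' : Quant) : ∀ {k s} → Formula k s → Set where
  sb-base : ∀ {k s} {φ : Formula k s} → ElemBlock Q' φ → SetBlock Q Q' φ
  sb-step : ∀ {k s} {φ : Formula k (suc s)} → SetBlock Q Q' φ → SetBlock Q Q' (qs Q φ)

MPrenex : Sentence → Set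
MPrenex ψ = Σ Quant λ Q → Σ Quant λ Q' → SetBlock Q Q' ψ

Equivalent : Sentence → Sentence → Set
Equivalent S T = ∀ (n : ℕ) (r : Subset n → ℕ) → Satisfies r S ⇔ Satisfies r T

InMLogic : Sentence → Set
InMLogic S = Σ Sentence λ ψ → MPrenex ψ × Equivalent S ψ

-- A minor M / C \ D of (E , r) isomorphic to N = (Fin m , rN) is pinned down by the
-- two sets C, D and the m elements x₀ … x_{m-1} that the isomorphism assigns to the
-- elements of N.  Since N is fixed and finite, every requirement on these data is a
-- finite quantifier-free conjunction: C ∩ D = ∅, the xᵢ are pairwise distinct and are
-- exactly the elements outside C ∪ D, and rN X + r C = r ({xᵢ | i ∈ X} ∪ C) for each
-- of the 2^m subsets X of Fin m.  Hence S_N = ∃C ∃D ∃x₀ … ∃x_{m-1} (conjunction) is in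
-- M-logic.  The rank equation is written with + because there is no subtraction in
-- MSOL; it agrees with the minor's rank r (· ∪ C) ∸ r C because r C ≤ r (Y ∪ C) (R2).
module Submission where

open import Defs
open import Data.Nat using (ℕ; zero; suc; _+_; _∸_; _≤_)
open import Data.Nat.Properties using (m+n∸n≡m; m∸n+n≡m)
open import Data.Bool using (true; false)
open import Data.Bool.Properties using (T-≡)
open import Data.Fin using (Fin) renaming (zero to fz; suc to fs)
open import Data.Fin.Properties using (any?) renaming (_≟_ to _≟ᶠ_)
open import Data.Fin.Subset using (Subset; ⁅_⁆; ∁; _∩_; _∪_; ∣_∣; _∈_; _∉_; _⊆_)
  renaming (⊤ to Eˢ)
open import Data.Fin.Subset.Properties
  using (_∈?_; _⊆?_; ∉⊥; ∈⊤; x∈⁅x⁆; x∈⁅y⁆⇒x≡y; ⊆-antisym; q⊆p∪q;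
         x∈p∪q⁺; x∈p∪q⁻; x∈∁p⇒x∉p; x∉p⇒x∈∁p)
open import Data.Vec using ([]; _∷_; lookup)
open import Data.Vec.Properties using (lookup⇒[]=; []=⇒lookup; lookup∘tabulate)
open import Data.Empty using (⊥-elim)
open import Data.Product using (Σ; ∃; _×_; _,_)
open import Data.Sum using (inj₁; inj₂; [_,_]′)
open import Function using (_∘_; id)
open import Function.Bundles using (_⇔_; mk⇔; Equivalence)
open import Function.Definitions using (Injective)
open import Relation.Nullary using (yes; no; does)
open import Relation.Nullary.Decidable using (_×-dec_; dec-true; toWitness; isYes; isYes≗does)
open import Relation.Binary.PropositionalEquality
  using (_≡_; _≗_; refl; sym; trans; cong; cong₂; subst; module ≡-Reasoning)

open Equivalence using (to; from)

+≡⇒≡∸ : ∀ {a b c} → a + b ≡ c → a ≡ c ∸ b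
+≡⇒≡∸ {a} {b} eq = trans (sym (m+n∸n≡m a b)) (cong (_∸ b) eq)

≡∸⇒+≡ : ∀ {a b c} → b ≤ c → a ≡ c ∸ b → a + b ≡ c
≡∸⇒+≡ {b = b} b≤c eq = trans (cong (_+ b) eq) (m∸n+n≡m b≤c)

module _ {n : ℕ} (r : Subset n → ℕ) where

  extE-cong : ∀ {k} a {ρ ρ' : Fin k → Fin n} → ρ ≗ ρ' → extE r a ρ ≗ extE r a ρ'
  extE-cong a ρ≗ρ' fz     = refl
  extE-cong a ρ≗ρ' (fs i) = ρ≗ρ' i

  ⟦⟧ˢ-cong : ∀ {k s} (t : SetTerm k s) {ρ ρ'} σ → ρ ≗ ρ' → ⟦_⟧ˢ r t ρ σ ≡ ⟦_⟧ˢ r t ρ' σ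
  ⟦⟧ˢ-cong E         σ ρ≗ρ' = refl
  ⟦⟧ˢ-cong ∅         σ ρ≗ρ' = refl
  ⟦⟧ˢ-cong (var j)   σ ρ≗ρ' = refl
  ⟦⟧ˢ-cong (sing i)  σ ρ≗ρ' = cong ⁅_⁆ (ρ≗ρ' i)
  ⟦⟧ˢ-cong (compl t) σ ρ≗ρ' = cong ∁ (⟦⟧ˢ-cong t σ ρ≗ρ')
  ⟦⟧ˢ-cong (t ∪ₜ u)  σ ρ≗ρ' = cong₂ _∪_ (⟦⟧ˢ-cong t σ ρ≗ρ') (⟦⟧ˢ-cong u σ ρ≗ρ')
  ⟦⟧ˢ-cong (t ∩ₜ u)  σ ρ≗ρ' = cong₂ _∩_ (⟦⟧ˢ-cong t σ ρ≗ρ') (⟦⟧ˢ-cong u σ ρ≗ρ')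

  ⟦⟧ⁱ-cong : ∀ {k s} (p : IntTerm k s) {ρ ρ'} σ → ρ ≗ ρ' → ⟦_⟧ⁱ r p ρ σ ≡ ⟦_⟧ⁱ r p ρ' σ
  ⟦⟧ⁱ-cong (const c) σ ρ≗ρ' = refl
  ⟦⟧ⁱ-cong (card t)  σ ρ≗ρ' = cong ∣_∣ (⟦⟧ˢ-cong t σ ρ≗ρ')
  ⟦⟧ⁱ-cong (rk t)    σ ρ≗ρ' = cong r (⟦⟧ˢ-cong t σ ρ≗ρ')
  ⟦⟧ⁱ-cong (p +ₜ q)  σ ρ≗ρ' = cong₂ _+_ (⟦⟧ⁱ-cong p σ ρ≗ρ') (⟦⟧ⁱ-cong q σ ρ≗ρ')

  Sat-resp-≗ : ∀ {k s} (φ : Formula k s) {ρ ρ'} σ → ρ ≗ ρ' → Sat r φ ρ σ → Sat r φ ρ' σ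
  Sat-resp-≗ (eqE i j)  σ ρ≗ρ' h = trans (sym (ρ≗ρ' i)) (trans h (ρ≗ρ' j))
  Sat-resp-≗ (eqS t u)  σ ρ≗ρ' h = trans (sym (⟦⟧ˢ-cong t σ ρ≗ρ')) (trans h (⟦⟧ˢ-cong u σ ρ≗ρ'))
  Sat-resp-≗ (subS t u) σ ρ≗ρ' h
    rewrite ⟦⟧ˢ-cong t σ ρ≗ρ' | ⟦⟧ˢ-cong u σ ρ≗ρ' = h
  Sat-resp-≗ (eqI p q)  σ ρ≗ρ' h = trans (sym (⟦⟧ⁱ-cong p σ ρ≗ρ')) (trans h (⟦⟧ⁱ-cong q σ ρ≗ρ'))
  Sat-resp-≗ (leI p q)  σ ρ≗ρ' h
    rewrite ⟦⟧ⁱ-cong p σ ρ≗ρ' | ⟦⟧ⁱ-cong q σ ρ≗ρ' = h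
  Sat-resp-≗ (mem i t)  σ ρ≗ρ' h
    rewrite ρ≗ρ' i | ⟦⟧ˢ-cong t σ ρ≗ρ' = h
  Sat-resp-≗ (neg φ)    σ ρ≗ρ' h = h ∘ Sat-resp-≗ φ σ (sym ∘ ρ≗ρ')
  Sat-resp-≗ (or φ ψ)   σ ρ≗ρ' (inj₁ h) = inj₁ (Sat-resp-≗ φ σ ρ≗ρ' h)
  Sat-resp-≗ (or φ ψ)   σ ρ≗ρ' (inj₂ h) = inj₂ (Sat-resp-≗ ψ σ ρ≗ρ' h)
  Sat-resp-≗ (and φ ψ)  σ ρ≗ρ' (h , h') = Sat-resp-≗ φ σ ρ≗ρ' h , Sat-resp-≗ ψ σ ρ≗ρ' h'
  Sat-resp-≗ (qe ∃q φ)  σ ρ≗ρ' (a , h) = a , Sat-resp-≗ φ σ (extE-cong a ρ≗ρ') h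
  Sat-resp-≗ (qe ∀q φ)  σ ρ≗ρ' h a = Sat-resp-≗ φ σ (extE-cong a ρ≗ρ') (h a)
  Sat-resp-≗ (qs ∃q φ)  σ ρ≗ρ' (A , h) = A , Sat-resp-≗ φ (extS r A σ) ρ≗ρ' h
  Sat-resp-≗ (qs ∀q φ)  σ ρ≗ρ' h A = Sat-resp-≗ φ (extS r A σ) ρ≗ρ' (h A)

∃ₑ* : ∀ {s} k → Formula k s → Formula 0 s
∃ₑ* zero    P = P
∃ₑ* (suc k) P = ∃ₑ* k (qe ∃q P)

∃ₑ*-ElemBlock : ∀ {s} k {P : Formula k s} → ElemBlock ∃q P → ElemBlock ∃q (∃ₑ* k P)
∃ₑ*-ElemBlock zero    P-block = P-block
∃ₑ*-ElemBlock (suc k) P-block = ∃ₑ*-ElemBlock k (eb-step P-block)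

Sat-∃ₑ* : ∀ {n s} (r : Subset n → ℕ) k (P : Formula k s) σ →
          Sat r (∃ₑ* k P) (noVarE r) σ ⇔ ∃ λ ρ → Sat r P ρ σ
Sat-∃ₑ* r k P σ = mk⇔ (witness k P) (λ (ρ , h) → introduce k P ρ h)
  where
  witness : ∀ k (P : Formula k _) → Sat r (∃ₑ* k P) (noVarE r) σ → ∃ λ ρ → Sat r P ρ σ
  witness zero    P h = noVarE r , h
  witness (suc k) P h with witness k (qe ∃q P) h
  ... | ρ , (a , h') = extE r a ρ , h'

  introduce : ∀ k (P : Formula k _) ρ → Sat r P ρ σ → Sat r (∃ₑ* k P) (noVarE r) σ
  introduce zero    P ρ h = Sat-resp-≗ r P σ (λ ()) h
  introduce (suc k) P ρ h = introduce k (qe ∃q P) (ρ ∘ fs)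
    (ρ fz , Sat-resp-≗ r P σ (λ { fz → refl ; (fs i) → refl }) h)

⊤ᶠ : ∀ {k s} → Formula k s
⊤ᶠ = eqS ∅ ∅

⋀ᶠ : ∀ {k s} j → (Fin j → Formula k s) → Formula k s
⋀ᶠ zero    f = ⊤ᶠ
⋀ᶠ (suc j) f = and (f fz) (⋀ᶠ j (f ∘ fs))

⋀ˢ : ∀ {k s} j → (Subset j → Formula k s) → Formula k s
⋀ˢ zero    f = f []
⋀ˢ (suc j) f = and (⋀ˢ j (f ∘ (true ∷_))) (⋀ˢ j (f ∘ (false ∷_)))

⋃ᶠ : ∀ {k s} j → (Fin j → SetTerm k s) → SetTerm k s
⋃ᶠ zero    f = ∅
⋃ᶠ (suc j) f = f fz ∪ₜ ⋃ᶠ j (f ∘ fs)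

⋀ᶠ-QF : ∀ {k s} j {f : Fin j → Formula k s} → (∀ i → QF (f i)) → QF (⋀ᶠ j f)
⋀ᶠ-QF zero    qf = qf-eqS
⋀ᶠ-QF (suc j) qf = qf-and (qf fz) (⋀ᶠ-QF j (qf ∘ fs))

⋀ˢ-QF : ∀ {k s} j {f : Subset j → Formula k s} → (∀ X → QF (f X)) → QF (⋀ˢ j f)
⋀ˢ-QF zero    qf = qf []
⋀ˢ-QF (suc j) qf = qf-and (⋀ˢ-QF j (qf ∘ (true ∷_))) (⋀ˢ-QF j (qf ∘ (false ∷_)))

module _ {n : ℕ} (r : Subset n → ℕ) {k s} (ρ : Fin k → Fin n) (σ : Fin s → Subset n) where

  Sat-⋀ᶠ : ∀ j (f : Fin j → Formula k s) → Sat r (⋀ᶠ j f) ρ σ ⇔ (∀ i → Sat r (f i) ρ σ)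
  Sat-⋀ᶠ j f = mk⇔ (conjunct j f) (conjunction j f)
    where
    conjunct : ∀ j (f : Fin j → Formula k s) → Sat r (⋀ᶠ j f) ρ σ → ∀ i → Sat r (f i) ρ σ
    conjunct (suc j) f (h , _) fz     = h
    conjunct (suc j) f (_ , h) (fs i) = conjunct j (f ∘ fs) h i

    conjunction : ∀ j (f : Fin j → Formula k s) → (∀ i → Sat r (f i) ρ σ) → Sat r (⋀ᶠ j f) ρ σ
    conjunction zero    f h = refl
    conjunction (suc j) f h = h fz , conjunction j (f ∘ fs) (h ∘ fs)

  Sat-⋀ˢ : ∀ j (f : Subset j → Formula k s) → Sat r (⋀ˢ j f) ρ σ ⇔ (∀ X → Sat r (f X) ρ σ)
  Sat-⋀ˢ j f = mk⇔ (conjunct j f) (conjunction j f)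
    where
    conjunct : ∀ j (f : Subset j → Formula k s) → Sat r (⋀ˢ j f) ρ σ → ∀ X → Sat r (f X) ρ σ
    conjunct zero    f h       []          = h
    conjunct (suc j) f (h , _) (true ∷ X)  = conjunct j (f ∘ (true ∷_)) h X
    conjunct (suc j) f (_ , h) (false ∷ X) = conjunct j (f ∘ (false ∷_)) h X

    conjunction : ∀ j (f : Subset j → Formula k s) → (∀ X → Sat r (f X) ρ σ) → Sat r (⋀ˢ j f) ρ σ
    conjunction zero    f h = h []
    conjunction (suc j) f h = conjunction j _ (h ∘ (true ∷_)) , conjunction j _ (h ∘ (false ∷_))

  ∈-⋃ᶠ : ∀ j (f : Fin j → SetTerm k s) {e} →
         e ∈ ⟦_⟧ˢ r (⋃ᶠ j f) ρ σ ⇔ ∃ λ i → e ∈ ⟦_⟧ˢ r (f i) ρ σ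
  ∈-⋃ᶠ j f = mk⇔ (member j f) (λ (i , h) → union j f i h)
    where
    member : ∀ j (f : Fin j → SetTerm k s) {e} → e ∈ ⟦_⟧ˢ r (⋃ᶠ j f) ρ σ →
             ∃ λ i → e ∈ ⟦_⟧ˢ r (f i) ρ σ
    member zero    f h = ⊥-elim (∉⊥ h)
    member (suc j) f h with x∈p∪q⁻ (⟦_⟧ˢ r (f fz) ρ σ) _ h
    ... | inj₁ h₀ = fz , h₀
    ... | inj₂ h₁ with member j (f ∘ fs) h₁
    ...   | i , hᵢ = fs i , hᵢ

    union : ∀ j (f : Fin j → SetTerm k s) {e} i → e ∈ ⟦_⟧ˢ r (f i) ρ σ →
            e ∈ ⟦_⟧ˢ r (⋃ᶠ j f) ρ σ
    union (suc j) f fz     h = x∈p∪q⁺ (inj₁ h)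
    union (suc j) f (fs i) h = x∈p∪q⁺ (inj₂ (union j (f ∘ fs) i h))

∈-img : ∀ {m n} (φ : Fin m → Fin n) X {e} → e ∈ img φ X ⇔ ∃ λ i → i ∈ X × φ i ≡ e
∈-img φ X {e} = mk⇔
  (λ h → toWitness {a? = preimage?} (from T-≡ (begin
      isYes preimage?            ≡⟨ isYes≗does preimage? ⟩
      does preimage?             ≡⟨ lookup∘tabulate _ e ⟨
      lookup (img φ X) e         ≡⟨ []=⇒lookup h ⟩
      true                       ∎)))
  (λ w → lookup⇒[]= e _ (trans (lookup∘tabulate _ e) (dec-true preimage? w)))
  where
  open ≡-Reasoning
  preimage? = any? λ i → (i ∈? X) ×-dec (φ i ≟ᶠ e)

∈∁∪ : ∀ {n} (C D : Subset n) {e} → e ∈ ∁ (C ∪ D) ⇔ (e ∉ C × e ∉ D)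
∈∁∪ C D = mk⇔
  (λ h → (λ e∈C → x∈∁p⇒x∉p h (x∈p∪q⁺ (inj₁ e∈C))) , (λ e∈D → x∈∁p⇒x∉p h (x∈p∪q⁺ (inj₂ e∈D))))
  (λ (e∉C , e∉D) → x∉p⇒x∈∁p ([ e∉C , e∉D ]′ ∘ x∈p∪q⁻ C D))

∁∪≡img⊤⇔onto : ∀ {m n} (C D : Subset n) (φ : Fin m → Fin n) →
               ∁ (C ∪ D) ≡ img φ Eˢ ⇔ (∀ e → (e ∉ C × e ∉ D) ⇔ ∃ λ i → φ i ≡ e)
∁∪≡img⊤⇔onto C D φ = mk⇔
  (λ eq e → mk⇔ (onto eq ∘ from (∈∁∪ C D)) (to (∈∁∪ C D) ∘ outside eq))
  (λ onto⇔ → ⊆-antisym (⊆-img onto⇔) (img-⊆ onto⇔))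
  where
  Onto = ∀ e → (e ∉ C × e ∉ D) ⇔ ∃ λ i → φ i ≡ e

  onto : ∁ (C ∪ D) ≡ img φ Eˢ → ∀ {e} → e ∈ ∁ (C ∪ D) → ∃ λ i → φ i ≡ e
  onto eq h with to (∈-img φ Eˢ) (subst (_ ∈_) eq h)
  ... | i , _ , φi≡e = i , φi≡e

  outside : ∁ (C ∪ D) ≡ img φ Eˢ → ∀ {e} → (∃ λ i → φ i ≡ e) → e ∈ ∁ (C ∪ D)
  outside eq (i , φi≡e) = subst (_ ∈_) (sym eq) (from (∈-img φ Eˢ) (i , ∈⊤ , φi≡e))

  ⊆-img : Onto → ∁ (C ∪ D) ⊆ img φ Eˢ
  ⊆-img onto⇔ {e} h with to (onto⇔ e) (to (∈∁∪ C D) h)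
  ... | i , φi≡e = from (∈-img φ Eˢ) (i , ∈⊤ , φi≡e)

  img-⊆ : Onto → img φ Eˢ ⊆ ∁ (C ∪ D)
  img-⊆ onto⇔ {e} h with to (∈-img φ Eˢ) h
  ... | i , _ , φi≡e = from (∈∁∪ C D) (from (onto⇔ e) (i , φi≡e))

memberTerm : ∀ {m s} → Subset m → Fin m → SetTerm m s
memberTerm X i with i ∈? X
... | yes _ = sing i
... | no  _ = ∅

imageTerm : ∀ {m s} → Subset m → SetTerm m s
imageTerm {m} X = ⋃ᶠ m (memberTerm X)

module _ {n : ℕ} (r : Subset n → ℕ) {m s} (ρ : Fin m → Fin n) (σ : Fin s → Subset n) where

  ∈-memberTerm : ∀ X i {e} → e ∈ ⟦_⟧ˢ r (memberTerm X i) ρ σ ⇔ (i ∈ X × ρ i ≡ e)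
  ∈-memberTerm X i with i ∈? X
  ... | yes i∈X = mk⇔ (λ h → i∈X , sym (x∈⁅y⁆⇒x≡y _ h)) (λ { (_ , refl) → x∈⁅x⁆ (ρ i) })
  ... | no  i∉X = mk⇔ (⊥-elim ∘ ∉⊥) (λ (i∈X , _) → ⊥-elim (i∉X i∈X))

  ⟦imageTerm⟧ : ∀ X → ⟦_⟧ˢ r (imageTerm X) ρ σ ≡ img ρ X
  ⟦imageTerm⟧ X = ⊆-antisym
    (λ h → let (i , hᵢ) = to (∈-⋃ᶠ r ρ σ m (memberTerm X)) h
           in from (∈-img ρ X) (i , to (∈-memberTerm X i) hᵢ))
    (λ h → let (i , i∈X , ρi≡e) = to (∈-img ρ X) h
           in from (∈-⋃ᶠ r ρ σ m (memberTerm X)) (i , from (∈-memberTerm X i) (i∈X , ρi≡e)))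

-- In the matrix of the sentence, set variable 1 is C and set variable 0 is D.
Cᵥ Dᵥ : ∀ {k} → SetTerm k 2
Cᵥ = var (fs fz)
Dᵥ = var fz

distinctF : ∀ {m s} → Fin m → Fin m → Formula m s
distinctF i j with i ≟ᶠ j
... | yes _ = ⊤ᶠ
... | no  _ = neg (eqE i j)

rankF : ∀ {m} → (Subset m → ℕ) → Subset m → Formula m 2
rankF rN X = eqI (const (rN X) +ₜ rk Cᵥ) (rk (imageTerm X ∪ₜ Cᵥ))

minorCondition : (m : ℕ) → (Subset m → ℕ) → Formula m 2
minorCondition m rN =
  and (eqS (Cᵥ ∩ₜ Dᵥ) ∅)
  (and (eqS (compl (Cᵥ ∪ₜ Dᵥ)) (imageTerm Eˢ))
  (and (⋀ᶠ m λ i → ⋀ᶠ m (distinctF i))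
       (⋀ˢ m (rankF rN))))

minorSentence : (m : ℕ) → (Subset m → ℕ) → Sentence
minorSentence m rN = qs ∃q (qs ∃q (∃ₑ* m (minorCondition m rN)))

minorSentence-MPrenex : ∀ m rN → MPrenex (minorSentence m rN)
minorSentence-MPrenex m rN =
  ∃q , ∃q , sb-step (sb-step (sb-base (∃ₑ*-ElemBlock m (eb-base matrix-QF))))
  where
  distinctF-QF : ∀ {m s} (i j : Fin m) → QF {s = s} (distinctF i j)
  distinctF-QF i j with i ≟ᶠ j
  ... | yes _ = qf-eqS
  ... | no  _ = qf-neg qf-eqE

  matrix-QF : QF (minorCondition m rN)
  matrix-QF = qf-and qf-eqS (qf-and qf-eqS (qf-and
    (⋀ᶠ-QF m (λ i → ⋀ᶠ-QF m (distinctF-QF i)))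
    (⋀ˢ-QF m (λ X → qf-eqI))))

module _ {n : ℕ} (r : Subset n → ℕ) {m} (ρ : Fin m → Fin n) (C D : Subset n) where

  private
    σ : Fin 2 → Subset n
    σ = extS r D (extS r C (noVarS r))

  Sat-distinctF : ∀ i j → Sat r (distinctF i j) ρ σ ⇔ (ρ i ≡ ρ j → i ≡ j)
  Sat-distinctF i j with i ≟ᶠ j
  ... | yes i≡j = mk⇔ (λ _ _ → i≡j) (λ _ → refl)
  ... | no  i≢j = mk⇔ (λ ρi≢ρj ρi≡ρj → ⊥-elim (ρi≢ρj ρi≡ρj)) (λ inj ρi≡ρj → i≢j (inj ρi≡ρj))

  Sat-distinct : Sat r (⋀ᶠ m λ i → ⋀ᶠ m (distinctF i)) ρ σ ⇔ Injective _≡_ _≡_ ρ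
  Sat-distinct = mk⇔
    (λ h {i} {j} → to (Sat-distinctF i j) (to (Sat-⋀ᶠ r ρ σ m _) (to (Sat-⋀ᶠ r ρ σ m _) h i) j))
    (λ inj → from (Sat-⋀ᶠ r ρ σ m _) λ i → from (Sat-⋀ᶠ r ρ σ m _) λ j →
      from (Sat-distinctF i j) inj)

  Sat-rankF : ∀ rN X → Sat r (rankF rN X) ρ σ ⇔ (rN X + r C ≡ r (img ρ X ∪ C))
  Sat-rankF rN X rewrite ⟦imageTerm⟧ r ρ σ X = mk⇔ id id

  Sat-minorCondition⇒MinorIso : ∀ rN → Sat r (minorCondition m rN) ρ σ → MinorIso n r m rN
  Sat-minorCondition⇒MinorIso rN (C∩D≡∅ , cover , distinct , ranks) = record
    { C = C ; D = D ; disjoint = C∩D≡∅ ; φ = ρ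
    ; φ-inj  = to Sat-distinct distinct
    ; φ-onto = to (∁∪≡img⊤⇔onto C D ρ) (trans cover (⟦imageTerm⟧ r ρ σ Eˢ))
    ; φ-rank = λ X → +≡⇒≡∸ (to (Sat-rankF rN X) (to (Sat-⋀ˢ r ρ σ m _) ranks X))
    }

Satisfies-minorSentence : ∀ {n} {r : Subset n → ℕ} {m} {rN : Subset m → ℕ} → IsMatroid n r →
                          Satisfies r (minorSentence m rN) ⇔ HasMinorIsoTo n r m rN
Satisfies-minorSentence {r = r} {m} {rN} isMatroid = mk⇔
  (λ (C , D , h) → let (ρ , hρ) = to (Sat-∃ₑ* r m _ _) h
                   in Sat-minorCondition⇒MinorIso r ρ C D rN hρ)
  (λ M → let open MinorIso M in
    C , D , from (Sat-∃ₑ* r m _ _) (φ , disjoint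
          , trans (from (∁∪≡img⊤⇔onto C D φ) φ-onto) (sym (⟦imageTerm⟧ r φ _ Eˢ))
          , from (Sat-distinct r φ C D) φ-inj
          , from (Sat-⋀ˢ r φ _ m _) λ X →
              from (Sat-rankF r φ C D rN X)
                   (≡∸⇒+≡ (R2 C (img φ X ∪ C) (q⊆p∪q (img φ X) C)) (φ-rank X))))
  where open IsMatroid isMatroid

IsMatroid⇔R123 : ∀ {n} (r : Subset n → ℕ) →
                 IsMatroid n r ⇔ (Satisfies r 𝐑1 × Satisfies r 𝐑2 × Satisfies r 𝐑3)
IsMatroid⇔R123 r = mk⇔
  (λ isMatroid → let open IsMatroid isMatroid in R1 , R2-sentence R2 , R3)
  (λ (r1 , r2 , r3) → record { R1 = r1 ; R2 = R2-axiom r2 ; R3 = r3 })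
  where
  R2-sentence : (∀ X Y → X ⊆ Y → r X ≤ r Y) → Satisfies r 𝐑2
  R2-sentence mono X Y with X ⊆? Y
  ... | yes X⊆Y = inj₂ (mono X Y X⊆Y)
  ... | no  X⊈Y = inj₁ X⊈Y

  R2-axiom : Satisfies r 𝐑2 → ∀ X Y → X ⊆ Y → r X ≤ r Y
  R2-axiom r2 X Y X⊆Y = [ (λ X⊈Y → ⊥-elim (X⊈Y X⊆Y)) , id ]′ (r2 X Y)

proposition3p2 : (m : ℕ) (rN : Subset m → ℕ) → IsMatroid m rN →
    Σ Sentence λ S → InMLogic S ×
      ((n : ℕ) (r : Subset n → ℕ) →
        (IsMatroid n r × HasMinorIsoTo n r m rN)
          ⇔ (Satisfies r 𝐑1 × Satisfies r 𝐑2 × Satisfies r 𝐑3 × Satisfies r S))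
proposition3p2 m rN _ =
  minorSentence m rN ,
  (minorSentence m rN , minorSentence-MPrenex m rN , λ _ _ → mk⇔ id id) ,
  λ n r → mk⇔
    (λ (isMatroid , M) →
      let (r1 , r2 , r3) = to (IsMatroid⇔R123 r) isMatroid
      in r1 , r2 , r3 , from (Satisfies-minorSentence isMatroid) M)
    (λ (r1 , r2 , r3 , s) →
      let isMatroid = from (IsMatroid⇔R123 r) (r1 , r2 , r3)
      in isMatroid , to (Satisfies-minorSentence isMatroid) s)
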